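{- Let $P,Q\subseteq\mathbb{N}^{\mathbb{N}}$ be recursively homeomorphic. If $P$ has the Pseudojump Inversion Property, then so does $Q$.
   Context: A recursive homeomorphism of $P$ onto $Q$ is a bijection $\Phi:P\to Q$ such that $\Phi$ and $\Phi^{ -1}:Q\to P$ are restrictions of partial recursive functionals to $P$ and $Q$ respectively; $P,Q$ are recursively homeomorphic if such a $\Phi$ exists. Reals are elements of $\mathbb{N}^{\mathbb{N}}$; $\le_T,\equiv_T$ Turing reducibility and equivalence; $0'$ the halting problem; $\oplus$ the join $(X\oplus Y)(2n)=X(n)$, $(X\oplus Y)(2n+1)=Y(n)$; $W_e^X$ the $e$-th $X$-r.e. set in a standard enumeration and $J_e(X)=X\oplus W_e^X$. A class $P$ has the Pseudojump Inversion Property if for every real $A\ge_T0'$ and every $e\in\mathbb{N}$ there is $B\in P$ with $A\equiv_T J_e(B)\equiv_T B\oplus 0'$. -}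

module Defs where

open import Level using (0ℓ)
open import Data.Nat using (ℕ; zero; suc; _+_; _*_; _^_)
open import Data.Fin using (Fin; toℕ)
open import Data.Vec using (Vec; []; _∷_; lookup)
open import Data.Product using (Σ; ∃; _×_)
open import Relation.Binary.PropositionalEquality using (_≡_)
open import Relation.Nullary using (Dec; yes; no)
open import Axiom.ExcludedMiddle using (ExcludedMiddle)

Real : Set
Real = ℕ → ℕ

Class : Set₁
Class = Real → Set

-- Kleene's partial recursive functions relative to an oracle X : ℕ → ℕ.
-- Code n = programs of arity n.

data Code : ℕ → Set where
  zer  : ∀ {n} → Code n
  sc   : Code 1
  proj : ∀ {n} → Fin n → Code n
  orc  : Code 1
  comp : ∀ {m n} → Code m → Vec (Code n) m → Code n
  prec : ∀ {n} → Code n → Code (2 + n) → Code (1 + n)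
      -- h(0,x)=f(x), h(y+1,x)=g(y,h(y,x),x)
  mu   : ∀ {n} → Code (1 + n) → Code n
      -- μy. f(y,x) = 0 (all f(z,x), z<y, defined and nonzero)

-- Big-step semantics: Eval X c xs v  means  Φ_c^X(xs) ↓ = v.
mutual
  data Eval (X : Real) : ∀ {n} → Code n → Vec ℕ n → ℕ → Set where
    ev-zer  : ∀ {n} {xs : Vec ℕ n} → Eval X zer xs 0
    ev-sc   : ∀ {x} → Eval X sc (x ∷ []) (suc x)
    ev-proj : ∀ {n} (i : Fin n) {xs : Vec ℕ n} → Eval X (proj i) xs (lookup xs i)
    ev-orc  : ∀ {x} → Eval X orc (x ∷ []) (X x)
    ev-comp : ∀ {m n} {f : Code m} {gs : Vec (Code n)  m} {xs : Vec ℕ n}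
                {ys : Vec ℕ m} {v : ℕ} →
              EvalAll X gs xs ys → Eval X f ys v → Eval X (comp f gs) xs v
    ev-prec0 : ∀ {n} {f : Code n} {g : Code (2 + n)} {xs : Vec ℕ n} {v : ℕ} →
               Eval X f xs v → Eval X (prec f g) (0 ∷ xs) v
    ev-precS : ∀ {n} {f : Code n} {g : Code (2 + n)} {xs : Vec ℕ n} {y u v : ℕ} →
               Eval X (prec f g) (y ∷ xs) u → Eval X g (y ∷ u ∷ xs) v →
               Eval X (prec f g) (suc y ∷ xs) v
    ev-mu   : ∀ {n} {f : Code (1 + n)} {xs : Vec ℕ n} {y : ℕ} →
              MuFrom X f xs 0 y → Eval X (mu f) xs y

  data EvalAll (X : Real) {n : ℕ} : ∀ {m} → Vec (Code n) m → Vec ℕ n → Vec ℕ m → Set where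
    []  : ∀ {xs} → EvalAll X [] xs []
    _∷_ : ∀ {m} {g : Code n} {gs : Vec (Code n) m} {xs : Vec ℕ n} {y : ℕ} {ys : Vec ℕ m} →
          Eval X g xs y → EvalAll X gs xs ys → EvalAll X (g ∷ gs) xs (y ∷ ys)

  data MuFrom (X : Real) {n : ℕ} (f : Code (1 + n)) (xs : Vec ℕ n) : ℕ → ℕ → Set where
    found : ∀ {k} → Eval X f (k ∷ xs) 0 → MuFrom X f xs k k
    step  : ∀ {k y v} → Eval X f (k ∷ xs) (suc v) → MuFrom X f xs (suc k) y →
            MuFrom X f xs k y

Computes : Code 1 → Real → Real → Set
Computes c X Y = ∀ n → Eval X c (n ∷ []) (Y n)

_≤T_ : Real → Real → Set
Y ≤T X = Σ (Code 1) λ c → Computes c X Y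

_≡T_ : Real → Real → Set
X ≡T Y = (X ≤T Y) × (Y ≤T X)

-- Recursive homeomorphism of P onto Q: Φ = Φ_c maps P into Q, Φ⁻¹ = Φ_d maps
-- Q into P, and they are mutually inverse (so Φ|P : P → Q is a bijection
-- with inverse Φ_d|Q).
RecHomeo : Class → Class → Set
RecHomeo P Q = Σ (Code 1) λ c → Σ (Code 1) λ d →
    (∀ X → P X → Σ Real λ Y → Q Y × Computes c X Y)
  × (∀ Y → Q Y → Σ Real λ X → P X × Computes d Y X)
  × (∀ X Y → P X → Computes c X Y → Computes d Y X)
  × (∀ X Y → Q Y → Computes d Y X → Computes c X Y)

-- Join: (X ⊕ Y)(2n) = X n, (X ⊕ Y)(2n+1) = Y n.

_⊕_ : Real → Real → Real
(X ⊕ Y) zero = X 0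
(X ⊕ Y) (suc zero) = Y 0
(X ⊕ Y) (suc (suc m)) = ((λ k → X (suc k)) ⊕ (λ k → Y (suc k))) m

χ : ExcludedMiddle 0ℓ → (ℕ → Set) → Real
χ lem S n with lem {S n}
... | yes _ = 1
... | no _  = 0

-- Gödel numbering of programs (injective, primitive recursive).

pair : ℕ → ℕ → ℕ
pair a b = 2 ^ a * (2 * b + 1)

mutual
  encode : ∀ {n} → Code n → ℕ
  encode {n} zer = pair 0 n
  encode sc = pair 1 0
  encode {n} (proj i) = pair 2 (pair n (toℕ i))
  encode orc = pair 3 0
  encode {n} (comp f gs) = pair 4 (pair n (pair (encode f) (encodeVec gs)))
  encode (prec f g) = pair 5 (pair (encode f) (encode g))
  encode (mu f) = pair 6 (encode f)

  encodeVec : ∀ {n m} → Vec (Code n) m → ℕ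
  encodeVec [] = 0
  encodeVec (g ∷ gs) = suc (pair (encode g) (encodeVec gs))

W : Code 1 → Real → ℕ → Set
W c X n = ∃ λ v → Eval X c (n ∷ []) v

-- Halting problem K = { e : φ_e(e) ↓ } (computations without oracle).
∅ : Real
∅ _ = 0

K : ℕ → Set
K e = Σ (Code 1) λ c → (encode c ≡ e) × W c ∅ e

0′ : ExcludedMiddle 0ℓ → Real
0′ lem = χ lem K

J : ExcludedMiddle 0ℓ → Code 1 → Real → Real
J lem e X = X ⊕ χ lem (W e X)

PJIP : ExcludedMiddle 0ℓ → Class → Set
PJIP lem P = ∀ (A : Real) → 0′ lem ≤T A → ∀ (e : Code 1) →
  Σ Real λ B → P B × (A ≡T J lem e B) × (J lem e B ≡T (B ⊕ 0′ lem))

module Submission where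

-- A recursive homeomorphism Φ = Φ_c preserves Turing degree: B ≡T Φ(B), with Φ_c and
-- Φ_d as the two reductions. Replacing every oracle query in a program e by the
-- program c gives e′ with W_{e′}^B = W_e^{Φ(B)}, hence J_{e′}(B) ≡T J_e(Φ(B)).
-- Since the join respects ≡T, a witness B ∈ P inverting J_{e′} is carried by Φ to a
-- witness Φ(B) ∈ Q inverting J_e.

open import Defs
open import Level using (0ℓ)
open import Axiom.ExcludedMiddle using (ExcludedMiddle)
open import Data.Nat using (ℕ; zero; suc)
open import Data.Fin using (Fin)
import Data.Fin as Fin
open import Data.Vec using (Vec; []; _∷_)
open import Data.Product using (Σ; _,_)
open import Data.Sum using (_⊎_; inj₁; inj₂)
open import Data.Empty using (⊥-elim)
open import Relation.Nullary using (yes; no)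
open import Relation.Binary.PropositionalEquality
  using (_≡_; _≗_; refl; sym; subst)

mutual
  Eval-deterministic : ∀ {X n} {c : Code n} {xs v w} →
                       Eval X c xs v → Eval X c xs w → v ≡ w
  Eval-deterministic ev-zer ev-zer = refl
  Eval-deterministic ev-sc ev-sc = refl
  Eval-deterministic (ev-proj i) (ev-proj .i) = refl
  Eval-deterministic ev-orc ev-orc = refl
  Eval-deterministic (ev-comp as f) (ev-comp bs g) with EvalAll-deterministic as bs
  ... | refl = Eval-deterministic f g
  Eval-deterministic (ev-prec0 a) (ev-prec0 b) = Eval-deterministic a b
  Eval-deterministic (ev-precS a f) (ev-precS b g) with Eval-deterministic a b
  ... | refl = Eval-deterministic f g
  Eval-deterministic (ev-mu r) (ev-mu s) = MuFrom-deterministic r s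

  EvalAll-deterministic : ∀ {X n m} {gs : Vec (Code n) m} {xs ys zs} →
                          EvalAll X gs xs ys → EvalAll X gs xs zs → ys ≡ zs
  EvalAll-deterministic [] [] = refl
  EvalAll-deterministic (a ∷ as) (b ∷ bs)
    with Eval-deterministic a b | EvalAll-deterministic as bs
  ... | refl | refl = refl

  MuFrom-deterministic : ∀ {X n} {f : Code (suc n)} {xs k y z} →
                         MuFrom X f xs k y → MuFrom X f xs k z → y ≡ z
  MuFrom-deterministic (found a) (found b) = refl
  MuFrom-deterministic (found a) (step b _) with Eval-deterministic a b
  ... | ()
  MuFrom-deterministic (step a _) (found b) with Eval-deterministic a b
  ... | ()
  MuFrom-deterministic (step a r) (step b s) = MuFrom-deterministic r s

mutual
  replaceOracle : ∀ {n} → Code n → Code 1 → Code n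
  replaceOracle zer c = zer
  replaceOracle sc c = sc
  replaceOracle (proj i) c = proj i
  replaceOracle orc c = c
  replaceOracle (comp f gs) c = comp (replaceOracle f c) (replaceOracleAll gs c)
  replaceOracle (prec f g) c = prec (replaceOracle f c) (replaceOracle g c)
  replaceOracle (mu f) c = mu (replaceOracle f c)

  replaceOracleAll : ∀ {n m} → Vec (Code n) m → Code 1 → Vec (Code n) m
  replaceOracleAll [] c = []
  replaceOracleAll (g ∷ gs) c = replaceOracle g c ∷ replaceOracleAll gs c

module _ {X Y : Real} {c : Code 1} (c-computes : Computes c X Y) where

  mutual
    replaceOracle-sound : ∀ {n} {d : Code n} {xs v} →
                          Eval Y d xs v → Eval X (replaceOracle d c) xs v
    replaceOracle-sound ev-zer = ev-zer
    replaceOracle-sound ev-sc = ev-sc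
    replaceOracle-sound (ev-proj i) = ev-proj i
    replaceOracle-sound (ev-orc {x}) = c-computes x
    replaceOracle-sound (ev-comp as f) =
      ev-comp (replaceOracleAll-sound as) (replaceOracle-sound f)
    replaceOracle-sound (ev-prec0 a) = ev-prec0 (replaceOracle-sound a)
    replaceOracle-sound (ev-precS a b) =
      ev-precS (replaceOracle-sound a) (replaceOracle-sound b)
    replaceOracle-sound (ev-mu r) = ev-mu (replaceOracleMu-sound r)

    replaceOracleAll-sound : ∀ {n m} {gs : Vec (Code n) m} {xs ys} →
                             EvalAll Y gs xs ys → EvalAll X (replaceOracleAll gs c) xs ys
    replaceOracleAll-sound [] = []
    replaceOracleAll-sound (a ∷ as) = replaceOracle-sound a ∷ replaceOracleAll-sound as

    replaceOracleMu-sound : ∀ {n} {f : Code (suc n)} {xs k y} →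
                            MuFrom Y f xs k y → MuFrom X (replaceOracle f c) xs k y
    replaceOracleMu-sound (found a) = found (replaceOracle-sound a)
    replaceOracleMu-sound (step a r) = step (replaceOracle-sound a) (replaceOracleMu-sound r)

  mutual
    replaceOracle-complete : ∀ {n} (d : Code n) {xs v} →
                             Eval X (replaceOracle d c) xs v → Eval Y d xs v
    replaceOracle-complete zer ev-zer = ev-zer
    replaceOracle-complete sc ev-sc = ev-sc
    replaceOracle-complete (proj i) (ev-proj .i) = ev-proj i
    replaceOracle-complete orc {x ∷ []} e with Eval-deterministic e (c-computes x)
    ... | refl = ev-orc
    replaceOracle-complete (comp f gs) (ev-comp as e) =
      ev-comp (replaceOracleAll-complete gs as) (replaceOracle-complete f e)
    replaceOracle-complete (prec f g) (ev-prec0 a) = ev-prec0 (replaceOracle-complete f a)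
    replaceOracle-complete (prec f g) (ev-precS a b) =
      ev-precS (replaceOracle-complete (prec f g) a) (replaceOracle-complete g b)
    replaceOracle-complete (mu f) (ev-mu r) = ev-mu (replaceOracleMu-complete f r)

    replaceOracleAll-complete : ∀ {n m} (gs : Vec (Code n) m) {xs ys} →
                                EvalAll X (replaceOracleAll gs c) xs ys → EvalAll Y gs xs ys
    replaceOracleAll-complete [] [] = []
    replaceOracleAll-complete (g ∷ gs) (a ∷ as) =
      replaceOracle-complete g a ∷ replaceOracleAll-complete gs as

    replaceOracleMu-complete : ∀ {n} (f : Code (suc n)) {xs k y} →
                               MuFrom X (replaceOracle f c) xs k y → MuFrom Y f xs k y
    replaceOracleMu-complete f (found a) = found (replaceOracle-complete f a)
    replaceOracleMu-complete f (step a r) =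
      step (replaceOracle-complete f a) (replaceOracleMu-complete f r)

  W-replaceOracle : ∀ (e : Code 1) n → W e Y n → W (replaceOracle e c) X n
  W-replaceOracle e n (v , run) = v , replaceOracle-sound run

  W-replaceOracle⁻ : ∀ (e : Code 1) n → W (replaceOracle e c) X n → W e Y n
  W-replaceOracle⁻ e n (v , run) = v , replaceOracle-complete e run

≤T-reflexive : ∀ {X Y} → X ≗ Y → X ≤T Y
≤T-reflexive {X} {Y} X≗Y = orc , λ n → subst (Eval Y orc (n ∷ [])) (sym (X≗Y n)) ev-orc

≤T-trans : ∀ {X Y Z} → X ≤T Y → Y ≤T Z → X ≤T Z
≤T-trans (c , c-computes) (d , d-computes) =
  replaceOracle c d , λ n → replaceOracle-sound d-computes (c-computes n)

≡T-sym : ∀ {X Y} → X ≡T Y → Y ≡T X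
≡T-sym (X≤Y , Y≤X) = Y≤X , X≤Y

≡T-trans : ∀ {X Y Z} → X ≡T Y → Y ≡T Z → X ≡T Z
≡T-trans (X≤Y , Y≤X) (Y≤Z , Z≤Y) = ≤T-trans X≤Y Y≤Z , ≤T-trans Z≤Y Y≤X

ifPos : ℕ → ℕ → ℕ → ℕ
ifPos zero a x = x
ifPos (suc _) a x = a

isZero : ℕ → ℕ
isZero zero = 1
isZero (suc _) = 0

parity : ℕ → ℕ
parity zero = 0
parity (suc y) = isZero (parity y)

half : ℕ → ℕ
half zero = 0
half (suc y) = ifPos (parity y) (suc (half y)) (half y)

double : ℕ → ℕ
double zero = 0
double (suc k) = suc (suc (double k))

parity-double : ∀ k → parity (double k) ≡ 0
parity-double zero = refl
parity-double (suc k) rewrite parity-double k = refl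

parity-suc-double : ∀ k → parity (suc (double k)) ≡ 1
parity-suc-double k rewrite parity-double k = refl

half-double : ∀ k → half (double k) ≡ k
half-double zero = refl
half-double (suc k) rewrite parity-double k | half-double k = refl

double-or-suc-double : ∀ m → Σ ℕ λ k → (m ≡ double k) ⊎ (m ≡ suc (double k))
double-or-suc-double zero = 0 , inj₁ refl
double-or-suc-double (suc m) with double-or-suc-double m
... | k , inj₁ refl = k , inj₂ refl
... | k , inj₂ refl = suc k , inj₁ refl

private
  #0 : Fin 2
  #0 = Fin.zero

  #1 : Fin 2
  #1 = Fin.suc Fin.zero

ifPosC : Code 3
ifPosC = prec (proj #1) (proj (Fin.suc (Fin.suc Fin.zero)))

isZeroC : Code 1
isZeroC = prec (comp sc (zer ∷ [])) zer

parityC : Code 1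
parityC = prec zer (comp isZeroC (proj #1 ∷ []))

halfC : Code 1
halfC = prec zer (comp ifPosC (comp parityC (proj #0 ∷ []) ∷ comp sc (proj #1 ∷ []) ∷ proj #1 ∷ []))

doubleC : Code 1
doubleC = prec zer (comp sc (comp sc (proj #1 ∷ []) ∷ []))

module _ {X : Real} where

  ifPosC-eval : ∀ b a x → Eval X ifPosC (b ∷ a ∷ x ∷ []) (ifPos b a x)
  ifPosC-eval zero a x = ev-prec0 (ev-proj #1)
  ifPosC-eval (suc b) a x = ev-precS (ifPosC-eval b a x) (ev-proj _)

  isZeroC-eval : ∀ y → Eval X isZeroC (y ∷ []) (isZero y)
  isZeroC-eval zero = ev-prec0 (ev-comp (ev-zer ∷ []) ev-sc)
  isZeroC-eval (suc y) = ev-precS (isZeroC-eval y) ev-zer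

  parityC-eval : ∀ y → Eval X parityC (y ∷ []) (parity y)
  parityC-eval zero = ev-prec0 ev-zer
  parityC-eval (suc y) = ev-precS (parityC-eval y) (ev-comp (ev-proj #1 ∷ []) (isZeroC-eval _))

  halfC-eval : ∀ y → Eval X halfC (y ∷ []) (half y)
  halfC-eval zero = ev-prec0 ev-zer
  halfC-eval (suc y) = ev-precS (halfC-eval y)
    (ev-comp (ev-comp (ev-proj #0 ∷ []) (parityC-eval y)
              ∷ ev-comp (ev-proj #1 ∷ []) ev-sc ∷ ev-proj #1 ∷ [])
             (ifPosC-eval _ _ _))

  doubleC-eval : ∀ y → Eval X doubleC (y ∷ []) (double y)
  doubleC-eval zero = ev-prec0 ev-zer
  doubleC-eval (suc y) = ev-precS (doubleC-eval y) (ev-comp (ev-comp (ev-proj #1 ∷ []) ev-sc ∷ []) ev-sc)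

⊕-double : ∀ (Y Z : Real) k → (Y ⊕ Z) (double k) ≡ Y k
⊕-double Y Z zero = refl
⊕-double Y Z (suc k) = ⊕-double (λ j → Y (suc j)) (λ j → Z (suc j)) k

⊕-suc-double : ∀ (Y Z : Real) k → (Y ⊕ Z) (suc (double k)) ≡ Z k
⊕-suc-double Y Z zero = refl
⊕-suc-double Y Z (suc k) = ⊕-suc-double (λ j → Y (suc j)) (λ j → Z (suc j)) k

⊕-congʳ : ∀ (Y : Real) {Z Z′ : Real} → Z ≗ Z′ → (Y ⊕ Z) ≗ (Y ⊕ Z′)
⊕-congʳ Y Z≗Z′ zero = refl
⊕-congʳ Y Z≗Z′ (suc zero) = Z≗Z′ 0
⊕-congʳ Y Z≗Z′ (suc (suc m)) = ⊕-congʳ (λ k → Y (suc k)) (λ k → Z≗Z′ (suc k)) m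

≤T-⊕ˡ : ∀ (Y Z : Real) → Y ≤T (Y ⊕ Z)
≤T-⊕ˡ Y Z = comp orc (doubleC ∷ []) , λ n →
  subst (Eval (Y ⊕ Z) (comp orc (doubleC ∷ [])) (n ∷ [])) (⊕-double Y Z n)
        (ev-comp (doubleC-eval n ∷ []) ev-orc)

-- On input m, read (Y ⊕ Z)(m) if m is odd, and compute X(m/2) from Y ⊕ Z otherwise.
⊕-monoˡ-≤T : ∀ {X Y} (Z : Real) → X ≤T Y → (X ⊕ Z) ≤T (Y ⊕ Z)
⊕-monoˡ-≤T {X} {Y} Z X≤Y with ≤T-trans X≤Y (≤T-⊕ˡ Y Z)
... | x , x-computes = r , λ m → subst (Eval (Y ⊕ Z) r (m ∷ [])) (r-value m) (r-eval m)
  where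
  r : Code 1
  r = comp ifPosC (parityC ∷ orc ∷ comp x (halfC ∷ []) ∷ [])

  r-eval : ∀ m → Eval (Y ⊕ Z) r (m ∷ []) (ifPos (parity m) ((Y ⊕ Z) m) (X (half m)))
  r-eval m = ev-comp (parityC-eval m ∷ ev-orc ∷ ev-comp (halfC-eval m ∷ []) (x-computes (half m)) ∷ [])
                     (ifPosC-eval _ _ _)

  r-value : ∀ m → ifPos (parity m) ((Y ⊕ Z) m) (X (half m)) ≡ (X ⊕ Z) m
  r-value m with double-or-suc-double m
  ... | k , inj₁ refl rewrite parity-double k | half-double k = sym (⊕-double X Z k)
  ... | k , inj₂ refl rewrite parity-suc-double k | ⊕-suc-double Y Z k = sym (⊕-suc-double X Z k)

⊕-congˡ-≡T : ∀ {X Y} (Z : Real) → X ≡T Y → (X ⊕ Z) ≡T (Y ⊕ Z)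
⊕-congˡ-≡T Z (X≤Y , Y≤X) = ⊕-monoˡ-≤T Z X≤Y , ⊕-monoˡ-≤T Z Y≤X

χ-cong : ∀ (lem : ExcludedMiddle 0ℓ) {S T : ℕ → Set} →
         (∀ n → S n → T n) → (∀ n → T n → S n) → χ lem S ≗ χ lem T
χ-cong lem {S} {T} S⊆T T⊆S n with lem {S n} | lem {T n}
... | yes _ | yes _ = refl
... | no _  | no _  = refl
... | yes s | no ¬t = ⊥-elim (¬t (S⊆T n s))
... | no ¬s | yes t = ⊥-elim (¬s (T⊆S n t))

J-replaceOracle : ∀ (lem : ExcludedMiddle 0ℓ) (e c d : Code 1) {B B′ : Real} →
                  Computes c B B′ → Computes d B′ B →
                  J lem e B′ ≡T J lem (replaceOracle e c) B
J-replaceOracle lem e c d {B} {B′} c-computes d-computes =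
  ≤T-trans (⊕-monoˡ-≤T S′ (c , c-computes)) (≤T-reflexive (⊕-congʳ B S′≗S)) ,
  ≤T-trans (≤T-reflexive (⊕-congʳ B (λ n → sym (S′≗S n)))) (⊕-monoˡ-≤T S′ (d , d-computes))
  where
  S′ = χ lem (W e B′)

  S′≗S : S′ ≗ χ lem (W (replaceOracle e c) B)
  S′≗S = χ-cong lem (W-replaceOracle c-computes e) (W-replaceOracle⁻ c-computes e)

lemma4p5 : (lem : ExcludedMiddle 0ℓ) → (P Q : Class) →
    RecHomeo P Q → PJIP lem P → PJIP lem Q
lemma4p5 lem P Q (c , d , Φ-into-Q , _ , Φ⁻¹-inverts , _) pjip-P A 0′≤A e
  with pjip-P A 0′≤A (replaceOracle e c)
... | B , PB , A≡J′B , J′B≡B⊕0′ with Φ-into-Q B PB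
... | B′ , QB′ , c-computes =
  B′ , QB′ , ≡T-trans A≡J′B (≡T-sym JB′≡J′B) ,
  ≡T-trans JB′≡J′B (≡T-trans J′B≡B⊕0′ (⊕-congˡ-≡T (0′ lem) B≡TB′))
  where
  d-computes : Computes d B′ B
  d-computes = Φ⁻¹-inverts B B′ PB c-computes

  B≡TB′ : B ≡T B′
  B≡TB′ = (d , d-computes) , (c , c-computes)

  JB′≡J′B : J lem e B′ ≡T J lem (replaceOracle e c) B
  JB′≡J′B = J-replaceOracle lem e c d c-computes d-computes
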